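{- Let $n\ge 5$. The shell graph $S_n$ has maximal total chord length among all maximal outerplanar graphs with $n$ vertices; that is, $TCL(G)\le TCL(S_n)$ for every maximal outerplanar graph $G$ of order $n$.
   Context: A maximal outerplanar graph of order $n$ is regarded as a drawing consisting of an $n$-cycle $\mathcal{C}$ together with a triangulation (by non-crossing edges between vertices of $\mathcal{C}$) of the bounded region determined by $\mathcal{C}$. Edges not in $\mathcal{C}$ are chords; the length of a chord is the length of a shortest path in $\mathcal{C}$ between its endpoints; $TCL(G)$ is the sum of the lengths of all chords. The shell graph $S_n$ is obtained from the $n$-cycle with vertices $v_1,\dots,v_n$ in clockwise order by adding the chords $v_1v_3, v_1v_4,\dots,v_1v_{n-2}$. -}

module Defs where

open import Data.Nat using (ℕ; zero; suc; _+_; _∸_; _≤_; _<_; _⊓_)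
open import Data.Product using (_×_; _,_)
open import Data.List using (List; map; upTo)
open import Data.Nat.ListAction using (sum)
open import Data.Sum using (_⊎_)
open import Data.List.Membership.Propositional using (_∈_)
open import Data.List.Relation.Unary.All using (All)
open import Data.List.Relation.Unary.Unique.Propositional using (Unique)
open import Relation.Nullary using (¬_)

-- Vertices of the n-cycle C are 0,1,…,n-1 (vertex v_{k+1} of the paper is k),
-- consecutive vertices (and n-1,0) adjacent.  A chord is a pair (i , j)
-- with i < j, stored with the smaller endpoint first.

Chord : Set
Chord = ℕ × ℕ

IsDiagonal : ℕ → Chord → Set
IsDiagonal n (i , j) = (i < j) × (j < n) × (2 ≤ j ∸ i) × (j ∸ i ≤ n ∸ 2)

-- Two diagonals cross (interiors intersect) iff their endpoints interleave.
Cross : Chord → Chord → Set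
Cross (a , b) (c , d) = ((a < c) × (c < b) × (b < d)) ⊎ ((c < a) × (a < d) × (d < b))

-- The maximal outerplanar graphs of order n
-- are exactly C plus such a chord set.
record MaximalOuterplanar (n : ℕ) (cs : List Chord) : Set where
  field
    diagonals   : All (IsDiagonal n) cs
    unique      : Unique cs
    noncrossing : ∀ {p q} → p ∈ cs → q ∈ cs → ¬ Cross p q
    maximal     : ∀ d → IsDiagonal n d → (∀ {p} → p ∈ cs → ¬ Cross d p) → d ∈ cs

-- length of a chord: shortest path in C between its endpoints
chordLength : ℕ → Chord → ℕ
chordLength n (i , j) = (j ∸ i) ⊓ (n ∸ (j ∸ i))

TCL : ℕ → List Chord → ℕ
TCL n cs = sum (map (chordLength n) cs)

-- chords of the shell graph S_n : v1v3, v1v4, …, v1v_{n-1}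
-- i.e. (0 , k) for k = 2, …, n-2  (n-3 chords)
shellChords : ℕ → List Chord
shellChords n = map (λ k → 0 , 2 + k) (upTo (n ∸ 3))

-- The chords of S_n have spans 2, 3, …, n − 2, one of each, so TCL(S_n) is the "fan sum"
-- Σ_{d=2}^{n-2} min(d, n − d).  By strong induction on b − a: an endpoint p of a widest chord of F
-- is straddled by no chord of F, so F splits into chords inside [a, p] and inside [p, b];
-- after removing the base chords (a , p) and (p , b) the induction hypothesis applies, and
-- the two fan sums merge because fan sums are superadditive.  Superadditivity holds since
-- min(d, n − d) increases with d as long as d ≤ n − d.
module Submission where

open import Defs
open import Data.Nat using (ℕ; zero; suc; _+_; _∸_; _≤_; _<_; _⊓_; z≤n; s≤s; _≤?_; _<?_; _≟_)
open import Data.Nat.Properties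
open import Algebra.Properties.CommutativeSemigroup +-commutativeSemigroup
  using (x∙yz≈y∙xz; x∙yz≈xz∙y)
open import Data.Nat.Induction using (<-rec)
open import Data.Nat.ListAction using (sum)
open import Data.Nat.ListAction.Properties using (sum-++)
open import Data.Product using (_×_; _,_; proj₁; proj₂; ∃; ∃₂)
open import Data.Product.Properties using (≡-dec)
open import Data.Sum using (_⊎_; inj₁; inj₂; [_,_]′)
open import Data.List using (List; []; _∷_; map; upTo; filter; [_]; _∷ʳ_)
open import Data.List.Properties using (map-++; upTo-∷ʳ)
open import Data.List.Extrema.Nat using (argmax; argmax-all; f[⊥]≤f[argmax]; f[xs]≤f[argmax])
open import Data.List.Membership.Propositional using (_∈_; _∉_)
open import Data.List.Membership.Propositional.Properties using (∈-filter⁻)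
open import Data.List.Relation.Unary.Any using (here; there)
open import Data.List.Relation.Unary.All as All using (All; []; _∷_)
open import Data.List.Relation.Unary.All.Properties using (all-filter)
open import Data.List.Relation.Unary.AllPairs using ([]; _∷_)
open import Data.List.Relation.Unary.Unique.Propositional using (Unique)
open import Data.List.Relation.Unary.Unique.Propositional.Properties using (filter⁺)
open import Relation.Binary.Definitions using (DecidableEquality)
open import Relation.Binary.PropositionalEquality hiding ([_])
open import Relation.Nullary using (¬_; yes; no; ¬?)
open import Relation.Nullary.Negation using (contradiction)
open import Relation.Unary using (Pred; Decidable)
open import Function using (_∘_)

sum-map-filter : ∀ {a p} {A : Set a} {P : Pred A p} (P? : Decidable P) (f : A → ℕ) xs →
  sum (map f xs) ≡ sum (map f (filter P? xs)) + sum (map f (filter (¬? ∘ P?) xs))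
sum-map-filter P? f [] = refl
sum-map-filter P? f (x ∷ xs) with P? x
... | yes _ = trans (cong (f x +_) (sum-map-filter P? f xs)) (sym (+-assoc (f x) _ _))
... | no  _ = trans (cong (f x +_) (sum-map-filter P? f xs))
                    (x∙yz≈y∙xz (f x) (sum (map f (filter P? xs))) _)

sum-map-remove : ∀ {a} {A : Set a} (_≟ᴬ_ : DecidableEquality A) (f : A → ℕ) x {xs} → Unique xs →
  sum (map f xs) ≤ f x + sum (map f (filter (¬? ∘ (_≟ᴬ x)) xs))
sum-map-remove _≟ᴬ_ f x {xs} uniq = begin
  sum (map f xs)
    ≡⟨ sum-map-filter (_≟ᴬ x) f xs ⟩
  sum (map f (filter (_≟ᴬ x) xs)) + sum (map f (filter (¬? ∘ (_≟ᴬ x)) xs))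
    ≤⟨ +-monoˡ-≤ _ (copies (filter⁺ (_≟ᴬ x) uniq) (all-filter (_≟ᴬ x) xs)) ⟩
  f x + sum (map f (filter (¬? ∘ (_≟ᴬ x)) xs))
    ∎
  where
  open ≤-Reasoning
  copies : ∀ {ys} → Unique ys → All (_≡ x) ys → sum (map f ys) ≤ f x
  copies [] [] = z≤n
  copies ([] ∷ []) (refl ∷ []) = ≤-reflexive (+-identityʳ (f x))
  copies ((y≢z ∷ _) ∷ _) (refl ∷ refl ∷ _) = contradiction refl y≢z

_≟ᶜ_ : DecidableEquality Chord
_≟ᶜ_ = ≡-dec _≟_ _≟_

span : Chord → ℕ
span c = proj₂ c ∸ proj₁ c

Within : ℕ → ℕ → Chord → Set
Within a b c = a ≤ proj₁ c × proj₂ c ≤ b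

Straddles : ℕ → Chord → Set
Straddles p c = proj₁ c < p × p < proj₂ c

NoneStraddles : ℕ → List Chord → Set
NoneStraddles p F = ∀ {d} → d ∈ F → ¬ Straddles p d

record NonCrossingIn (a b : ℕ) (F : List Chord) : Set where
  field
    within      : ∀ {c} → c ∈ F → Within a b c
    wide        : ∀ {c} → c ∈ F → 2 ≤ span c
    unique      : Unique F
    noncrossing : ∀ {c d} → c ∈ F → d ∈ F → ¬ Cross c d

wide⇒ordered : ∀ {c} → 2 ≤ span c → proj₁ c < proj₂ c
wide⇒ordered = m∸n≢0⇒n<m ∘ m<n⇒n≢0

span-within : ∀ {a b k c} → Within a b c → a + k ≡ b → span c ≤ k
span-within {a} {k = k} (a≤i , j≤b) refl = ≤-trans (∸-mono j≤b a≤i) (≤-reflexive (m+n∸m≡n a k))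

NonCrossingIn-filter : ∀ {a b a′ b′ F p} {P : Pred Chord p} (P? : Decidable P) →
  NonCrossingIn a b F → (∀ {c} → c ∈ F → P c → Within a′ b′ c) → NonCrossingIn a′ b′ (filter P? F)
NonCrossingIn-filter {F = F} P? fam within′ = record
  { within      = λ c∈ → let c∈F , Pc = ∈-filter⁻ P? {xs = F} c∈ in within′ c∈F Pc
  ; wide        = wide ∘ kept
  ; unique      = filter⁺ P? unique
  ; noncrossing = λ c∈ d∈ → noncrossing (kept c∈) (kept d∈)
  }
  where
  open NonCrossingIn fam
  kept : ∀ {c} → c ∈ filter P? F → c ∈ F
  kept = proj₁ ∘ ∈-filter⁻ P? {xs = F}

endsBy? : (p : ℕ) → Decidable (λ (c : Chord) → proj₂ c ≤ p)
endsBy? p c = proj₂ c ≤? p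

splitAt : ∀ {a b p F} → NonCrossingIn a b F → NoneStraddles p F →
  NonCrossingIn a p (filter (endsBy? p) F) × NonCrossingIn p b (filter (¬? ∘ endsBy? p) F)
splitAt {a} {b} {p} {F} fam none =
  NonCrossingIn-filter (endsBy? p) fam left , NonCrossingIn-filter (¬? ∘ endsBy? p) fam right
  where
  open NonCrossingIn fam
  left : ∀ {c} → c ∈ F → proj₂ c ≤ p → Within a p c
  left c∈ j≤p = proj₁ (within c∈) , j≤p
  right : ∀ {c} → c ∈ F → ¬ proj₂ c ≤ p → Within p b c
  right c∈ j≰p = ≮⇒≥ (λ i<p → none c∈ (i<p , ≰⇒> j≰p)) , proj₂ (within c∈)

straddles-start : ∀ {c d} → proj₁ c < proj₂ c → Straddles (proj₁ c) d → Cross c d ⊎ span c < span d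
straddles-start {c} {d} u<v (i<u , u<j) with proj₂ d <? proj₂ c
... | yes j<v = inj₁ (inj₂ (i<u , u<j , j<v))
... | no  j≮v = inj₂ (≤-<-trans (∸-monoˡ-≤ (proj₁ c) (≮⇒≥ j≮v)) (∸-monoʳ-< i<u (<⇒≤ u<j)))

straddles-end : ∀ {c d} → proj₁ c < proj₂ c → Straddles (proj₂ c) d → Cross c d ⊎ span c < span d
straddles-end {c} {d} u<v (i<v , v<j) with proj₁ c <? proj₁ d
... | yes u<i = inj₁ (inj₁ (u<i , i<v , v<j))
... | no  u≮i = inj₂ (≤-<-trans (∸-monoʳ-≤ (proj₂ c) (≮⇒≥ u≮i)) (∸-monoˡ-< v<j (<⇒≤ i<v)))

module _ {a b F w} (fam : NonCrossingIn a b F) (w∈F : w ∈ F)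
         (widest : ∀ {d} → d ∈ F → span d ≤ span w) where
  open NonCrossingIn fam

  private
    u<v : proj₁ w < proj₂ w
    u<v = wide⇒ordered (wide w∈F)

    unstraddled : ∀ {d} → d ∈ F → ¬ (Cross w d ⊎ span w < span d)
    unstraddled d∈ = [ noncrossing w∈F d∈ , (λ w<d → <⇒≱ w<d (widest d∈)) ]′

  widest-splitPoint : (a , b) ∉ F → ∃ λ p → a < p × p < b × NoneStraddles p F
  widest-splitPoint ab∉F with m≤n⇒m<n∨m≡n (proj₂ (within w∈F))
  ... | inj₁ v<b = proj₂ w , ≤-<-trans (proj₁ (within w∈F)) u<v , v<b ,
                   λ d∈ → unstraddled d∈ ∘ straddles-end u<v
  ... | inj₂ v≡b = proj₁ w , ≤∧≢⇒< (proj₁ (within w∈F)) a≢u , subst (proj₁ w <_) v≡b u<v ,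
                   λ d∈ → unstraddled d∈ ∘ straddles-start u<v
    where
    a≢u : a ≢ proj₁ w
    a≢u refl = ab∉F (subst (λ v → (a , v) ∈ F) v≡b w∈F)

splitPoint : ∀ {a b c cs} → NonCrossingIn a b (c ∷ cs) → (a , b) ∉ c ∷ cs →
  ∃ λ p → a < p × p < b × NoneStraddles p (c ∷ cs)
splitPoint {c = c} {cs} fam = widest-splitPoint fam widest∈ widest
  where
  widest∈ : argmax span c cs ∈ c ∷ cs
  widest∈ = argmax-all span (here refl) (All.tabulate there)
  widest : ∀ {d} → d ∈ c ∷ cs → span d ≤ span (argmax span c cs)
  widest (here refl) = f[⊥]≤f[argmax] {f = span} c cs
  widest (there d∈) = All.lookup (f[xs]≤f[argmax] {f = span} c cs) d∈

splitLength : ∀ {a p b k} → a < p → p < b → a + suc (suc k) ≡ b →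
  ∃₂ λ x y → a + suc x ≡ p × p + suc y ≡ b × x + y ≡ k
splitLength {a} {p} {b} {k} a<p p<b a+k≡b = x , y , a+x≡p , p+y≡b , x+y≡k
  where
  open ≡-Reasoning
  x y : ℕ
  x = p ∸ suc a
  y = b ∸ suc p
  a+x≡p : a + suc x ≡ p
  a+x≡p = trans (+-suc a x) (m+[n∸m]≡n a<p)
  p+y≡b : p + suc y ≡ b
  p+y≡b = trans (+-suc p y) (m+[n∸m]≡n p<b)
  x+y≡k : x + y ≡ k
  x+y≡k = suc-injective (suc-injective (+-cancelˡ-≡ a _ _ (begin
    a + suc (suc (x + y)) ≡⟨ cong (λ t → a + suc t) (sym (+-suc x y)) ⟩
    a + (suc x + suc y)   ≡⟨ sym (+-assoc a (suc x) (suc y)) ⟩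
    a + suc x + suc y     ≡⟨ cong (_+ suc y) a+x≡p ⟩
    p + suc y             ≡⟨ p+y≡b ⟩
    b                     ≡⟨ sym a+k≡b ⟩
    a + suc (suc k)       ∎)))

fanChord : ℕ → Chord
fanChord k = 0 , 2 + k

fanChords : ℕ → List Chord
fanChords m = map fanChord (upTo m)

module _ (n : ℕ) where

  spanLength : ℕ → ℕ
  spanLength d = d ⊓ (n ∸ d)

  fanLength : ℕ → ℕ
  fanLength zero    = 0
  fanLength (suc k) = fanLength k + spanLength (2 + k)

  spanLength-mono : ∀ {d e} → d ≤ e → d + e ≤ n → spanLength d ≤ spanLength e
  spanLength-mono {d} d≤e d+e≤n =
    ⊓-glb (≤-trans (m⊓n≤m d _) d≤e) (≤-trans (m⊓n≤m d _) (m+n≤o⇒m≤o∸n d d+e≤n))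

  fanLength-superadditive : ∀ x y → 2 + (x + y) < n → fanLength x + fanLength y ≤ fanLength (x + y)
  fanLength-superadditive x y x+y<n = [ merge x y x+y<n , swapped ]′ (≤-total y x)
    where
    open ≤-Reasoning
    -- The terms of fanLength y, from the last one down, are dominated by the terms
    -- spanLength (2 + x), spanLength (3 + x), … that fanLength (x + y) adds to fanLength x.
    merge : ∀ x y → 2 + (x + y) < n → y ≤ x → fanLength x + fanLength y ≤ fanLength (x + y)
    merge x zero _ _ = ≤-reflexive (trans (+-identityʳ _) (cong fanLength (sym (+-identityʳ x))))
    merge x (suc z) x+y<n z<x = begin
      fanLength x + (fanLength z + spanLength (2 + z))
        ≤⟨ +-monoʳ-≤ (fanLength x) (+-monoʳ-≤ (fanLength z) (spanLength-mono (s≤s (s≤s (<⇒≤ z<x))) spans≤n)) ⟩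
      fanLength x + (fanLength z + spanLength (2 + x))
        ≡⟨ x∙yz≈xz∙y (fanLength x) (fanLength z) (spanLength (2 + x)) ⟩
      fanLength (suc x) + fanLength z
        ≤⟨ merge (suc x) z (subst (λ t → 2 + t < n) (+-suc x z) x+y<n) (m≤n⇒m≤1+n (<⇒≤ z<x)) ⟩
      fanLength (suc x + z)
        ≡⟨ cong fanLength (sym (+-suc x z)) ⟩
      fanLength (x + suc z)
        ∎
      where
      spans≤n : (2 + z) + (2 + x) ≤ n
      spans≤n = subst (_≤ n) (sym (trans (+-comm (2 + z) (2 + x)) (cong (suc ∘ suc) (+-suc x (suc z)))))
                      x+y<n
    swapped : x ≤ y → fanLength x + fanLength y ≤ fanLength (x + y)
    swapped x≤y = subst₂ (λ s t → s ≤ fanLength t) (+-comm (fanLength y) (fanLength x)) (+-comm y x)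
      (merge y x (subst (λ t → 2 + t < n) (+-comm x y) x+y<n) x≤y)

  TCL-∷ʳ : ∀ cs c → TCL n (cs ∷ʳ c) ≡ TCL n cs + chordLength n c
  TCL-∷ʳ cs c = begin
    sum (map (chordLength n) (cs ∷ʳ c))             ≡⟨ cong sum (map-++ (chordLength n) cs [ c ]) ⟩
    sum (map (chordLength n) cs ∷ʳ chordLength n c) ≡⟨ sum-++ (map (chordLength n) cs) [ chordLength n c ] ⟩
    TCL n cs + (chordLength n c + 0)                ≡⟨ cong (TCL n cs +_) (+-identityʳ _) ⟩
    TCL n cs + chordLength n c                      ∎
    where open ≡-Reasoning

  TCL-fanChords : ∀ m → TCL n (fanChords m) ≡ fanLength m
  TCL-fanChords zero    = refl
  TCL-fanChords (suc m) = begin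
    TCL n (fanChords (suc m))                          ≡⟨ cong (TCL n ∘ map fanChord) (sym (upTo-∷ʳ m)) ⟩
    TCL n (map fanChord (upTo m ∷ʳ m))                 ≡⟨ cong (TCL n) (map-++ fanChord (upTo m) [ m ]) ⟩
    TCL n (fanChords m ∷ʳ fanChord m)                  ≡⟨ TCL-∷ʳ (fanChords m) (fanChord m) ⟩
    TCL n (fanChords m) + spanLength (2 + m)           ≡⟨ cong (_+ spanLength (2 + m)) (TCL-fanChords m) ⟩
    fanLength (suc m)                                  ∎
    where open ≡-Reasoning

  -- In the open case the base chord (a , b) is excluded, so F is a set of non-crossing
  -- diagonals of the (k + 3)-gon a, a + 1, …, b.
  ClosedBound OpenBound : ℕ → Set
  ClosedBound k = ∀ {a b F} → a + suc k ≡ b → suc k < n → NonCrossingIn a b F →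
    TCL n F ≤ fanLength k
  OpenBound k = ∀ {a b F} → a + suc (suc k) ≡ b → 2 + k < n → NonCrossingIn a b F → (a , b) ∉ F →
    TCL n F ≤ fanLength k

  openBound : ∀ k → (∀ {x} → x ≤ k → ClosedBound x) → OpenBound k
  openBound k closed {F = []} _ _ _ _ = z≤n
  openBound k closed {a} {b} {F@(_ ∷ _)} a+k≡b k<n fam ab∉F
    with p , a<p , p<b , none ← splitPoint fam ab∉F
    with x , y , a+x≡p , p+y≡b , refl ← splitLength a<p p<b a+k≡b
    with famˡ , famʳ ← splitAt fam none
    = begin
      TCL n F
        ≡⟨ sum-map-filter (endsBy? p) (chordLength n) F ⟩
      TCL n (filter (endsBy? p) F) + TCL n (filter (¬? ∘ endsBy? p) F)
        ≤⟨ +-mono-≤ (closed (m≤m+n x y) a+x≡p (shorter (m≤m+n x y)) famˡ)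
                    (closed (m≤n+m y x) p+y≡b (shorter (m≤n+m y x)) famʳ) ⟩
      fanLength x + fanLength y
        ≤⟨ fanLength-superadditive x y k<n ⟩
      fanLength (x + y)
        ∎
    where
    open ≤-Reasoning
    shorter : ∀ {z} → z ≤ x + y → suc z < n
    shorter z≤k = ≤-trans (s≤s (s≤s z≤k)) (<⇒≤ k<n)

  closedBound : ∀ k → ClosedBound k
  closedBound = <-rec ClosedBound step
    where
    step : ∀ k → (∀ {x} → x < k → ClosedBound x) → ClosedBound k
    step zero _ {F = []} _ _ _ = z≤n
    step zero _ {F = _ ∷ _} a+1≡b _ fam = contradiction 2≤1 1+n≰n
      where
      open NonCrossingIn fam
      2≤1 : 2 ≤ 1
      2≤1 = ≤-trans (wide (here refl)) (span-within (within (here refl)) a+1≡b)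
    step (suc k) shorter {a} {b} {F} a+k≡b k<n fam = begin
      TCL n F
        ≤⟨ sum-map-remove _≟ᶜ_ (chordLength n) (a , b) unique ⟩
      spanLength (b ∸ a) + TCL n F′
        ≡⟨ cong (λ s → spanLength s + TCL n F′) b∸a≡k ⟩
      spanLength (2 + k) + TCL n F′
        ≤⟨ +-monoʳ-≤ _ (openBound k (shorter ∘ s≤s) a+k≡b k<n fam′ ab∉F′) ⟩
      spanLength (2 + k) + fanLength k
        ≡⟨ +-comm (spanLength (2 + k)) (fanLength k) ⟩
      fanLength (suc k)
        ∎
      where
      open ≤-Reasoning
      open NonCrossingIn fam
      F′ : List Chord
      F′ = filter (¬? ∘ (_≟ᶜ (a , b))) F
      fam′ : NonCrossingIn a b F′
      fam′ = NonCrossingIn-filter _ fam (λ c∈ _ → within c∈)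
      ab∉F′ : (a , b) ∉ F′
      ab∉F′ ab∈ = proj₂ (∈-filter⁻ (¬? ∘ (_≟ᶜ (a , b))) {xs = F} ab∈) refl
      b∸a≡k : b ∸ a ≡ 2 + k
      b∸a≡k = trans (cong (_∸ a) (sym a+k≡b)) (m+n∸m≡n a (2 + k))

MaximalOuterplanar-nonCrossing : ∀ {n cs} → MaximalOuterplanar (3 + n) cs →
  NonCrossingIn 0 (2 + n) cs × (0 , 2 + n) ∉ cs
MaximalOuterplanar-nonCrossing {n} {cs} mo = record
  { within      = λ c∈ → z≤n , ≤-pred (proj₁ (proj₂ (diagonal c∈)))
  ; wide        = λ c∈ → proj₁ (proj₂ (proj₂ (diagonal c∈)))
  ; unique      = unique
  ; noncrossing = noncrossing
  } , λ c∈ → <-irrefl refl (proj₂ (proj₂ (proj₂ (diagonal c∈))))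
  where
  open MaximalOuterplanar mo
  diagonal : ∀ {c} → c ∈ cs → IsDiagonal (3 + n) c
  diagonal = All.lookup diagonals

-- The hypothesis 5 ≤ n only rules out n < 3, where there are no diagonals.
theorem5 : (n : ℕ) → 5 ≤ n → (cs : List Chord) → MaximalOuterplanar n cs →
    TCL n cs ≤ TCL n (shellChords n)
theorem5 n@(suc (suc (suc m))) (s≤s (s≤s (s≤s _))) cs mo
  with nonCrossing , base∉cs ← MaximalOuterplanar-nonCrossing mo = begin
    TCL n cs              ≤⟨ openBound n m (λ _ → closedBound n _) refl ≤-refl nonCrossing base∉cs ⟩
    fanLength n m         ≡⟨ sym (TCL-fanChords n m) ⟩
    TCL n (shellChords n) ∎
  where open ≤-Reasoning
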